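{- For $k\geq 0$ let $T_k(x)=\sum_{n\geq k+1}\frac{p_n^{n-k}}{(n-1)!}x^n$. Then $T_0(x)=xP(x)$ and for every $k\geq 1$ $$T_k(x)=T_{k-1}(x)+\frac{(k+1)^{k-1}}{k!}x^{k+1}P(x)-\frac{2(k+1)^{k-2}}{(k-1)!}x^k,$$ equivalently $$T_k(x)=P(x)\sum_{i=0}^{k}\frac{(i+1)^{i-1}}{i!}x^{i+1}-\sum_{i=1}^k\frac{2(i+1)^{i-2}}{(i-1)!}x^i.$$
   Context: There are $n$ parking spaces in a line numbered $1,\dots,n$; $n$ cars arrive in order, car $j$ has preference $a_j\in[n]$ and parks in the first unoccupied space numbered $\geq a_j$, if any; $(a_1,\dots,a_n)$ is a parking function if all cars park. $p_n^l$ is the number of parking functions $(a_1,\dots,a_n)$ of length $n$ with $a_1=l$. $P(x)=\sum_{n\geq 0}\frac{(n+1)^{n-1}}{n!}x^n$. -}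

module Defs where

open import Data.Nat as ℕ using (ℕ; zero; suc; _∸_; _!; _^_; _≤ᵇ_; _≡ᵇ_)
open import Data.Nat.Properties using (_!≢0; m^n≢0)
open import Data.Bool using (Bool; true; false; if_then_else_; _∧_)
open import Data.List using (List; []; _∷_; map; concatMap; upTo; replicate)
open import Data.Maybe using (Maybe; just; nothing; is-just)
import Data.Maybe as Maybe
open import Data.Integer as ℤ using (ℤ; +_; -[1+_])
open import Data.Rational using (ℚ; _/_; _+_; _*_; _-_; 0ℚ)

-- Occupancy of spaces 1..n as a list of Booleans (true = occupied).
-- parkFrom a s : the car with preference a parks in the first unoccupied
-- space with number ≥ a (spaces numbered from 1); nothing if none.
parkFrom : ℕ → List Bool → Maybe (List Bool)
parkFrom a [] = nothing
parkFrom (suc (suc a)) (b ∷ bs) = Maybe.map (b ∷_) (parkFrom (suc a) bs)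
parkFrom a (false ∷ bs) = just (true ∷ bs)
parkFrom a (true ∷ bs) = Maybe.map (true ∷_) (parkFrom a bs)

runCars : List ℕ → List Bool → Maybe (List Bool)
runCars [] s = just s
runCars (a ∷ as) s with parkFrom a s
... | nothing = nothing
... | just s' = runCars as s'

isParkingFunction : ℕ → List ℕ → Bool
isParkingFunction n as = is-just (runCars as (replicate n false))

sequences : ℕ → ℕ → List (List ℕ)
sequences zero n = [] ∷ []
sequences (suc m) n = concatMap (λ a → map (a ∷_) (sequences m n)) (map suc (upTo n))

firstIs : ℕ → List ℕ → Bool
firstIs l [] = false
firstIs l (a ∷ _) = a ≡ᵇ l

countTrue : List Bool → ℕ
countTrue [] = 0
countTrue (true ∷ bs) = suc (countTrue bs)
countTrue (false ∷ bs) = countTrue bs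

p : ℕ → ℕ → ℕ
p n l = countTrue (map (λ as → isParkingFunction n as ∧ firstIs l as) (sequences n n))

-- (suc b)^e for an integer exponent e
powℤ : ℕ → ℤ → ℚ
powℤ b (+ m) = (+ (suc b ^ m)) / 1
powℤ b -[1+ m ] = (+ 1 / (suc b ^ suc m)) {{m^n≢0 (suc b) (suc m)}}

inv! : ℕ → ℚ
inv! m = (+ 1 / (m !)) {{m !≢0}}

Series : Set
Series = ℕ → ℚ

_⊕_ : Series → Series → Series
(f ⊕ g) n = f n + g n

_⊖_ : Series → Series → Series
(f ⊖ g) n = f n - g n

sumTo : ℕ → (ℕ → ℚ) → ℚ
sumTo zero h = h 0
sumTo (suc n) h = sumTo n h + h (suc n)

_⊛_ : Series → Series → Series
(f ⊛ g) n = sumTo n (λ i → f i * g (n ∸ i))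

mono : ℚ → ℕ → Series
mono c j n = if j ≡ᵇ n then c else 0ℚ

-- finite sum of series Σ_{i=a}^{b} F i  (empty, i.e. 0, if b < a)
sumSeries : ℕ → ℕ → (ℕ → Series) → Series
sumSeries a b F n = go (suc b ∸ a)
  where
  go : ℕ → ℚ
  go zero = 0ℚ
  go (suc m) = go m + F (a ℕ.+ m) n

cP : ℕ → ℚ
cP i = powℤ i (+ i ℤ.- + 1) * inv! i

P : Series
P n = cP n

-- 2 (i+1)^{i-2} / (i-1)!   (used for i ≥ 1)
d : ℕ → ℚ
d i = (+ 2 / 1) * powℤ i (+ i ℤ.- + 2) * inv! (i ∸ 1)

T : ℕ → Series
T k n = if suc k ≤ᵇ n then (+ p n (n ∸ k) / 1) * inv! (n ∸ 1) else 0ℚ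

X : Series
X = mono ((+ 1) / 1) 1

module Submission where

-- Everything is reduced to counting.  A street is a list of occupied/free
-- spaces; the cars parking on it are characterised by a recursive criterion
-- (at each space, no more cars may reach it than there are free spaces from
-- there on), which yields a recursion for the number count S m of ways m
-- cars park on S: peeling off the first space is a binomial sum ("layer").
--
--  * On an empty street this recursion is solved in closed form by an
--    Abel-type binomial identity: (n+1)·E(n,m) = (n+1-m)(n+1)^m.
--  * p_n^l counts the ways the other cars park after the first took space l.
--    This gives p_n^n = n^{n-2} and p_n^1 = 2(n+1)^{n-2}; and moving the
--    occupied space from j+1 to j+2 (a swap of two adjacent spaces behind j
--    empty ones) gives, for n = k+j+1, k ≥ 1,
--        p_n^{j+1} - p_n^{j+2} = C(k+j,k) (k+1)^{k-1} (j+1)^{j-1}.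
--  * Dividing by (n-1)! turns these three facts into the coefficientwise
--    statements T_0 = xP, the recurrence for T_k, and, by induction on k,
--    the closed form.

open import Defs
open import Data.Nat using (ℕ; suc; _≤_; _∸_)
open import Data.Product using (_×_; _,_; proj₁; proj₂)
open import Relation.Binary.PropositionalEquality using (_≡_)

module Combinatorics where

  open import Data.Nat
    using (ℕ; zero; suc; _≤_; _<_; _∸_; _+_; _*_; _^_; _!; _≤ᵇ_; _≡ᵇ_; z≤n; s≤s; NonZero)
  import Data.Nat.Properties as ℕₚ
  open import Data.Nat.Tactic.RingSolver using (solve-∀)
  open import Data.Bool using (Bool; true; false; _∧_) renaming (T to IsTrue)
  import Data.Bool.Properties as Boolₚ
  open import Data.List using (List; []; _∷_; map; concatMap; upTo; replicate; length; _++_; [_])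
  open import Data.Nat.ListAction using (sum)
  open import Data.Nat.ListAction.Properties using (sum-++)
  import Data.List.Properties as Listₚ
  open import Data.Maybe using (Maybe; just; nothing; is-just)
  import Data.Maybe as Maybe
  open import Data.Unit using (tt)
  open import Data.Empty using (⊥-elim)
  open import Function using (_∘_; id)
  open import Relation.Nullary using (¬_; yes; no)
  open import Relation.Binary using (tri<; tri≈; tri>)
  open import Relation.Binary.PropositionalEquality hiding ([_])
  open ≡-Reasoning

  IsTrue⇒≡true : ∀ {b} → IsTrue b → b ≡ true
  IsTrue⇒≡true {true} _ = refl

  ≤⇒≤ᵇ≡true : ∀ {m n} → m ≤ n → (m ≤ᵇ n) ≡ true
  ≤⇒≤ᵇ≡true m≤n = IsTrue⇒≡true (ℕₚ.≤⇒≤ᵇ m≤n)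

  ≰⇒≤ᵇ≡false : ∀ {m n} → ¬ m ≤ n → (m ≤ᵇ n) ≡ false
  ≰⇒≤ᵇ≡false {m} {n} m≰n with m ≤ᵇ n in eq
  ... | false = refl
  ... | true = ⊥-elim (m≰n (ℕₚ.≤ᵇ⇒≤ m n (subst IsTrue (sym eq) tt)))

  ≤ᵇ-suc : ∀ m n → (suc m ≤ᵇ suc n) ≡ (m ≤ᵇ n)
  ≤ᵇ-suc zero n = refl
  ≤ᵇ-suc (suc m) n = refl

  ≡ᵇ-refl : ∀ n → (n ≡ᵇ n) ≡ true
  ≡ᵇ-refl n = IsTrue⇒≡true (ℕₚ.≡⇒≡ᵇ n n refl)

  ≢⇒≡ᵇ≡false : ∀ {m n} → m ≢ n → (m ≡ᵇ n) ≡ false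
  ≢⇒≡ᵇ≡false {m} {n} m≢n with m ≡ᵇ n in eq
  ... | false = refl
  ... | true = ⊥-elim (m≢n (ℕₚ.≡ᵇ⇒≡ m n (subst IsTrue (sym eq) tt)))

  𝟙 : Bool → ℕ
  𝟙 true = 1
  𝟙 false = 0

  𝟙-∧ : ∀ x y → 𝟙 (x ∧ y) ≡ 𝟙 x * 𝟙 y
  𝟙-∧ true y = sym (ℕₚ.+-identityʳ _)
  𝟙-∧ false y = refl

  *-vanishesʳ : ∀ a {b} → b ≡ 0 → a * b ≡ 0
  *-vanishesʳ a b≡0 = trans (cong (a *_) b≡0) (ℕₚ.*-zeroʳ a)

  -- Reading the street from the left, a list of cars parks iff
  -- at every space there are at least as many free spaces from there on as
  -- cars that reach that space; the cars that pass space 1 are those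
  -- preferring ≥ 2, and seen from space 2 their preferences drop by one.

  freeSpaces : List Bool → ℕ
  freeSpaces [] = 0
  freeSpaces (false ∷ S) = suc (freeSpaces S)
  freeSpaces (true ∷ S) = freeSpaces S

  -- the cars that drive past the first space, with preferences shifted
  passFirst : List ℕ → List ℕ
  passFirst [] = []
  passFirst (zero ∷ a) = passFirst a
  passFirst (suc zero ∷ a) = passFirst a
  passFirst (suc (suc x) ∷ a) = suc x ∷ passFirst a

  criterion : List Bool → List ℕ → Bool
  criterion [] [] = true
  criterion [] (_ ∷ _) = false
  criterion (b ∷ S) a = (length a ≤ᵇ freeSpaces (b ∷ S)) ∧ criterion S (passFirst a)

  criterionAfter : Maybe (List Bool) → List ℕ → Bool
  criterionAfter nothing _ = false
  criterionAfter (just S) a = criterion S a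

  length-passFirst : ∀ a → length (passFirst a) ≤ length a
  length-passFirst [] = z≤n
  length-passFirst (zero ∷ a) = ℕₚ.m≤n⇒m≤1+n (length-passFirst a)
  length-passFirst (suc zero ∷ a) = ℕₚ.m≤n⇒m≤1+n (length-passFirst a)
  length-passFirst (suc (suc x) ∷ a) = s≤s (length-passFirst a)

  passFirst-front : ∀ x → x ≤ 1 → ∀ a → passFirst (x ∷ a) ≡ passFirst a
  passFirst-front zero _ a = refl
  passFirst-front (suc zero) _ a = refl
  passFirst-front (suc (suc x)) (s≤s ()) a

  freeSpaces-cons : ∀ b S S' → freeSpaces S ≡ suc (freeSpaces S') →
                    freeSpaces (b ∷ S) ≡ suc (freeSpaces (b ∷ S'))
  freeSpaces-cons false S S' e = cong suc e
  freeSpaces-cons true S S' e = e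

  park-uses-space : ∀ x S S' → parkFrom x S ≡ just S' → freeSpaces S ≡ suc (freeSpaces S')
  park-uses-space x [] S' ()
  park-uses-space (suc (suc x)) (b ∷ S) S' eq with parkFrom (suc x) S in e
  park-uses-space (suc (suc x)) (false ∷ S) S' refl | just S″ = cong suc (park-uses-space (suc x) S S″ e)
  park-uses-space (suc (suc x)) (true ∷ S) S' refl | just S″ = park-uses-space (suc x) S S″ e
  park-uses-space zero (false ∷ S) S' refl = refl
  park-uses-space (suc zero) (false ∷ S) S' refl = refl
  park-uses-space zero (true ∷ S) S' eq with parkFrom zero S in e
  ... | just S″ with eq
  ... | refl = park-uses-space zero S S″ e
  park-uses-space (suc zero) (true ∷ S) S' eq with parkFrom (suc zero) S in e
  ... | just S″ with eq
  ... | refl = park-uses-space (suc zero) S S″ e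

  park-fails-full : ∀ x → x ≤ 1 → ∀ S → parkFrom x S ≡ nothing → freeSpaces S ≡ 0
  park-fails-full x x≤1 [] eq = refl
  park-fails-full zero x≤1 (true ∷ S) eq with parkFrom zero S in e
  ... | nothing = park-fails-full zero x≤1 S e
  park-fails-full (suc zero) x≤1 (true ∷ S) eq with parkFrom (suc zero) S in e
  ... | nothing = park-fails-full (suc zero) x≤1 S e
  park-fails-full zero x≤1 (false ∷ S) ()
  park-fails-full (suc zero) x≤1 (false ∷ S) ()
  park-fails-full (suc (suc x)) (s≤s ()) (b ∷ S) eq

  criterion-spare : ∀ x → x ≤ 1 → ∀ S S' a → parkFrom x S ≡ just S' →
                    length a < freeSpaces S → criterion S a ≡ criterion S' a
  criterion-spare x x≤1 [] S' a () lt
  criterion-spare zero x≤1 (false ∷ S) .(true ∷ S) a refl (s≤s lt)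
    rewrite ≤⇒≤ᵇ≡true (ℕₚ.m≤n⇒m≤1+n lt) | ≤⇒≤ᵇ≡true lt = refl
  criterion-spare (suc zero) x≤1 (false ∷ S) .(true ∷ S) a refl (s≤s lt)
    rewrite ≤⇒≤ᵇ≡true (ℕₚ.m≤n⇒m≤1+n lt) | ≤⇒≤ᵇ≡true lt = refl
  criterion-spare (suc (suc x)) (s≤s ()) (b ∷ S) S' a eq lt
  criterion-spare zero x≤1 (true ∷ S) S' a eq lt with parkFrom zero S in e
  ... | just S″ with eq
  ... | refl rewrite ≤⇒≤ᵇ≡true (ℕₚ.<⇒≤ lt)
                   | ≤⇒≤ᵇ≡true (ℕₚ.≤-pred (subst (length a <_) (park-uses-space zero S S″ e) lt))
    = criterion-spare zero x≤1 S S″ (passFirst a) e (ℕₚ.≤-<-trans (length-passFirst a) lt)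
  criterion-spare (suc zero) x≤1 (true ∷ S) S' a eq lt with parkFrom (suc zero) S in e
  ... | just S″ with eq
  ... | refl rewrite ≤⇒≤ᵇ≡true (ℕₚ.<⇒≤ lt)
                   | ≤⇒≤ᵇ≡true (ℕₚ.≤-pred (subst (length a <_) (park-uses-space (suc zero) S S″ e) lt))
    = criterion-spare (suc zero) x≤1 S S″ (passFirst a) e (ℕₚ.≤-<-trans (length-passFirst a) lt)

  criterion-step-occupied : ∀ x → x ≤ 1 → ∀ S a →
    criterion (true ∷ S) (x ∷ a) ≡ criterionAfter (Maybe.map (true ∷_) (parkFrom x S)) a
  criterion-step-occupied x x≤1 S a rewrite passFirst-front x x≤1 a with parkFrom x S in e
  ... | nothing rewrite park-fails-full x x≤1 S e = refl
  ... | just S' rewrite park-uses-space x S S' e | ≤ᵇ-suc (length a) (freeSpaces S')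
                  with length a ≤ᵇ freeSpaces S' in room
  ...   | false = refl
  ...   | true = cong (true ∧_) (criterion-spare x x≤1 S S' (passFirst a) e
                   (subst (length (passFirst a) <_) (sym (park-uses-space x S S' e))
                     (s≤s (ℕₚ.≤-trans (length-passFirst a) (ℕₚ.≤ᵇ⇒≤ _ _ (subst IsTrue (sym room) tt))))))

  criterion-step : ∀ S x a → criterion S (x ∷ a) ≡ criterionAfter (parkFrom x S) a
  criterion-step [] x a = refl
  criterion-step (b ∷ S) (suc (suc y)) a rewrite criterion-step S (suc y) (passFirst a)
    with parkFrom (suc y) S in e
  ... | nothing = Boolₚ.∧-zeroʳ _
  ... | just S' rewrite freeSpaces-cons b S S' (park-uses-space (suc y) S S' e)
                      | ≤ᵇ-suc (length a) (freeSpaces (b ∷ S')) = refl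
  criterion-step (false ∷ S) zero a rewrite ≤ᵇ-suc (length a) (freeSpaces S) = refl
  criterion-step (false ∷ S) (suc zero) a rewrite ≤ᵇ-suc (length a) (freeSpaces S) = refl
  criterion-step (true ∷ S) zero a = criterion-step-occupied zero z≤n S a
  criterion-step (true ∷ S) (suc zero) a = criterion-step-occupied (suc zero) (s≤s z≤n) S a

  criterion-[] : ∀ S → criterion S [] ≡ true
  criterion-[] [] = refl
  criterion-[] (b ∷ S) = criterion-[] S

  parks⇔criterion : ∀ a S → is-just (runCars a S) ≡ criterion S a
  parks⇔criterion [] S = sym (criterion-[] S)
  parks⇔criterion (x ∷ a) S rewrite criterion-step S x a with parkFrom x S
  ... | nothing = refl
  ... | just S' = parks⇔criterion a S'

  sumOver : {A : Set} → List A → (A → ℕ) → ℕ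
  sumOver xs f = sum (map f xs)

  sumSeq : ℕ → ℕ → (List ℕ → ℕ) → ℕ
  sumSeq m n h = sumOver (sequences m n) h

  entries : ℕ → List ℕ
  entries n = map suc (upTo n)

  countTrue-sum : ∀ {A : Set} (f : A → Bool) xs → countTrue (map f xs) ≡ sumOver xs (𝟙 ∘ f)
  countTrue-sum f [] = refl
  countTrue-sum f (x ∷ xs) with f x
  ... | true = cong suc (countTrue-sum f xs)
  ... | false = countTrue-sum f xs

  sumOver-cong : ∀ {A : Set} (xs : List A) {f g : A → ℕ} → (∀ x → f x ≡ g x) → sumOver xs f ≡ sumOver xs g
  sumOver-cong xs eq = cong sum (Listₚ.map-cong eq xs)

  sumOver-++ : ∀ {A : Set} (xs ys : List A) f → sumOver (xs ++ ys) f ≡ sumOver xs f + sumOver ys f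
  sumOver-++ xs ys f = trans (cong sum (Listₚ.map-++ f xs ys)) (sum-++ (map f xs) (map f ys))

  sumOver-map : ∀ {A B : Set} (xs : List A) (g : A → B) f → sumOver (map g xs) f ≡ sumOver xs (f ∘ g)
  sumOver-map xs g f = cong sum (sym (Listₚ.map-∘ xs))

  sumOver-concatMap : ∀ {A B : Set} (xs : List A) (g : A → List B) f →
    sumOver (concatMap g xs) f ≡ sumOver xs (λ x → sumOver (g x) f)
  sumOver-concatMap [] g f = refl
  sumOver-concatMap (x ∷ xs) g f =
    trans (sumOver-++ (g x) (concatMap g xs) f) (cong (sumOver (g x) f +_) (sumOver-concatMap xs g f))

  sumOver-* : ∀ {A : Set} (xs : List A) c f → sumOver xs (λ x → c * f x) ≡ c * sumOver xs f
  sumOver-* [] c f = sym (ℕₚ.*-zeroʳ c)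
  sumOver-* (x ∷ xs) c f =
    trans (cong (c * f x +_) (sumOver-* xs c f)) (sym (ℕₚ.*-distribˡ-+ c (f x) _))

  sumOver-0 : ∀ {A : Set} (xs : List A) → sumOver xs (λ _ → 0) ≡ 0
  sumOver-0 [] = refl
  sumOver-0 (x ∷ xs) = sumOver-0 xs

  sumSeq-suc : ∀ m n h → sumSeq (suc m) n h ≡ sumOver (entries n) (λ x → sumSeq m n (λ a → h (x ∷ a)))
  sumSeq-suc m n h =
    trans (sumOver-concatMap (entries n) _ h)
          (sumOver-cong (entries n) (λ x → sumOver-map (sequences m n) (x ∷_) h))

  sumSeq-* : ∀ m n c h → sumSeq m n (λ a → c * h a) ≡ c * sumSeq m n h
  sumSeq-* m n c h = sumOver-* (sequences m n) c h

  sumSeq-length : ∀ m n (f : ℕ → List ℕ → ℕ) → sumSeq m n (λ a → f (length a) a) ≡ sumSeq m n (f m)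
  sumSeq-length zero n f = refl
  sumSeq-length (suc m) n f =
    trans (sumSeq-suc m n _)
          (trans (sumOver-cong (entries n) (λ x → sumSeq-length m n (λ l a → f (suc l) (x ∷ a))))
                 (sym (sumSeq-suc m n (f (suc m)))))

  entries-suc : ∀ n → entries (suc n) ≡ 1 ∷ map suc (entries n)
  entries-suc n = cong (λ xs → 1 ∷ map suc xs) (sym (Listₚ.map-applyUpTo id suc n))

  sumUpTo : ℕ → (ℕ → ℕ) → ℕ
  sumUpTo zero f = f 0
  sumUpTo (suc m) f = f 0 + sumUpTo m (λ i → f (suc i))

  sumUpTo-cong≤ : ∀ m {f g} → (∀ i → i ≤ m → f i ≡ g i) → sumUpTo m f ≡ sumUpTo m g
  sumUpTo-cong≤ zero eq = eq 0 z≤n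
  sumUpTo-cong≤ (suc m) eq = cong₂ _+_ (eq 0 z≤n) (sumUpTo-cong≤ m (λ i le → eq (suc i) (s≤s le)))

  sumUpTo-cong : ∀ m {f g} → (∀ i → f i ≡ g i) → sumUpTo m f ≡ sumUpTo m g
  sumUpTo-cong m eq = sumUpTo-cong≤ m (λ i _ → eq i)

  sumUpTo-+ : ∀ m f g → sumUpTo m (λ i → f i + g i) ≡ sumUpTo m f + sumUpTo m g
  sumUpTo-+ zero f g = refl
  sumUpTo-+ (suc m) f g rewrite sumUpTo-+ m (λ i → f (suc i)) (λ i → g (suc i)) = swap (f 0) (g 0) _ _
    where
    swap : ∀ a b c d → (a + b) + (c + d) ≡ (a + c) + (b + d)
    swap = solve-∀

  sumUpTo-* : ∀ m c f → sumUpTo m (λ i → c * f i) ≡ c * sumUpTo m f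
  sumUpTo-* zero c f = refl
  sumUpTo-* (suc m) c f rewrite sumUpTo-* m c (λ i → f (suc i)) = sym (ℕₚ.*-distribˡ-+ c (f 0) _)

  sumUpTo-last : ∀ m f → sumUpTo (suc m) f ≡ sumUpTo m f + f (suc m)
  sumUpTo-last zero f = refl
  sumUpTo-last (suc m) f rewrite sumUpTo-last m (λ i → f (suc i)) = sym (ℕₚ.+-assoc (f 0) _ _)

  sumUpTo-zero : ∀ m f → (∀ i → i ≤ m → f i ≡ 0) → sumUpTo m f ≡ 0
  sumUpTo-zero zero f eq = eq 0 z≤n
  sumUpTo-zero (suc m) f eq rewrite eq 0 z≤n = sumUpTo-zero m (λ i → f (suc i)) (λ i le → eq (suc i) (s≤s le))

  sumUpTo-top : ∀ m f → (∀ i → i < m → f i ≡ 0) → sumUpTo m f ≡ f m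
  sumUpTo-top zero f eq = refl
  sumUpTo-top (suc m) f eq rewrite eq 0 (s≤s z≤n) =
    sumUpTo-top m (λ i → f (suc i)) (λ i lt → eq (suc i) (s≤s lt))

  sumUpTo-split : ∀ a t f → (∀ i → i < a → f i ≡ 0) → sumUpTo (a + t) f ≡ sumUpTo t (λ s → f (a + s))
  sumUpTo-split zero t f eq = refl
  sumUpTo-split (suc a) t f eq rewrite eq 0 (s≤s z≤n) =
    sumUpTo-split a t (λ i → f (suc i)) (λ i lt → eq (suc i) (s≤s lt))

  sumOver-sumUpTo : ∀ {A : Set} (xs : List A) m (g : A → ℕ → ℕ) →
    sumOver xs (λ x → sumUpTo m (g x)) ≡ sumUpTo m (λ i → sumOver xs (λ x → g x i))
  sumOver-sumUpTo [] m g = sym (sumUpTo-zero m _ (λ _ _ → refl))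
  sumOver-sumUpTo (x ∷ xs) m g rewrite sumOver-sumUpTo xs m g = sym (sumUpTo-+ m (g x) _)

  binom : ℕ → ℕ → ℕ
  binom n zero = 1
  binom zero (suc k) = 0
  binom (suc n) (suc k) = binom n k + binom n (suc k)

  binom-> : ∀ m k → m < k → binom m k ≡ 0
  binom-> zero (suc k) lt = refl
  binom-> (suc m) (suc k) (s≤s lt) rewrite binom-> m k lt | binom-> m (suc k) (ℕₚ.m≤n⇒m≤1+n lt) = refl

  binom-diag : ∀ n → binom n n ≡ 1
  binom-diag zero = refl
  binom-diag (suc n) rewrite binom-diag n | binom-> n (suc n) ℕₚ.≤-refl = refl

  sumUpTo-binom-extend : ∀ m (B : ℕ → ℕ) → sumUpTo (suc m) (λ i → binom m i * B i) ≡ sumUpTo m (λ i → binom m i * B i)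
  sumUpTo-binom-extend m B =
    trans (sumUpTo-last m (λ i → binom m i * B i))
          (trans (cong (λ c → sumUpTo m (λ i → binom m i * B i) + c * B (suc m)) (binom-> m (suc m) ℕₚ.≤-refl))
                 (ℕₚ.+-identityʳ _))

  pascal : ∀ m (B : ℕ → ℕ) → sumUpTo (suc m) (λ i → binom (suc m) i * B i)
    ≡ sumUpTo m (λ i → binom m i * B (suc i)) + sumUpTo m (λ i → binom m i * B i)
  pascal m B =
    begin
      B 0 + 0 + sumUpTo m (λ i → binom (suc m) (suc i) * B (suc i))
    ≡⟨ cong (B 0 + 0 +_) (trans (sumUpTo-cong m (λ i → ℕₚ.*-distribʳ-+ (B (suc i)) (binom m i) (binom m (suc i))))
                                  (sumUpTo-+ m (λ i → binom m i * B (suc i)) (λ i → binom m (suc i) * B (suc i)))) ⟩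
      B 0 + 0 + (Xs + sumUpTo m (λ i → binom m (suc i) * B (suc i)))
    ≡⟨ rearrange (B 0) Xs _ ⟩
      Xs + sumUpTo (suc m) (λ i → binom m i * B i)
    ≡⟨ cong (Xs +_) (sumUpTo-binom-extend m B) ⟩
      Xs + sumUpTo m (λ i → binom m i * B i)
    ∎
    where
    Xs = sumUpTo m (λ i → binom m i * B (suc i))
    rearrange : ∀ a b c → a + 0 + (b + c) ≡ b + (a + 0 + c)
    rearrange = solve-∀

  -- Counting lemma: among the sequences over [n+1] of length m, those in
  -- which exactly i entries exceed 1 arise from the C(m,i) choices of
  -- positions and a sequence over [n] of length i (their shifts).
  sumSeq-passFirst : ∀ m n h →
    sumSeq m (suc n) (λ a → h (passFirst a)) ≡ sumUpTo m (λ i → binom m i * sumSeq i n h)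
  sumSeq-passFirst zero n h = sym (ℕₚ.+-identityʳ _)
  sumSeq-passFirst (suc m) n h =
    begin
      sumSeq (suc m) (suc n) (λ a → h (passFirst a))
    ≡⟨ sumSeq-suc m (suc n) _ ⟩
      sumOver (entries (suc n)) (λ x → sumSeq m (suc n) (λ a → h (passFirst (x ∷ a))))
    ≡⟨ cong (λ xs → sumOver xs (λ x → sumSeq m (suc n) (λ a → h (passFirst (x ∷ a))))) (entries-suc n) ⟩
      sumSeq m (suc n) (λ a → h (passFirst a))
        + sumOver (map suc (entries n)) (λ x → sumSeq m (suc n) (λ a → h (passFirst (x ∷ a))))
    ≡⟨ cong₂ _+_ (sumSeq-passFirst m n h)
         (trans (sumOver-map (entries n) suc _)
           (trans (sumOver-map (upTo n) suc _)
             (sumOver-cong (upTo n) (λ y → sumSeq-passFirst m n (λ b → h (suc y ∷ b)))))) ⟩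
      sumUpTo m (λ i → binom m i * sumSeq i n h)
        + sumOver (upTo n) (λ y → sumUpTo m (λ i → binom m i * sumSeq i n (λ b → h (suc y ∷ b))))
    ≡⟨ cong (sumUpTo m (λ i → binom m i * sumSeq i n h) +_)
         (trans (sumOver-sumUpTo (upTo n) m _)
           (sumUpTo-cong m (λ i → trans (sumOver-* (upTo n) (binom m i) _)
             (cong (binom m i *_) (trans (sym (sumOver-map (upTo n) suc _)) (sym (sumSeq-suc i n h))))))) ⟩
      sumUpTo m (λ i → binom m i * sumSeq i n h) + sumUpTo m (λ i → binom m i * sumSeq (suc i) n h)
    ≡⟨ ℕₚ.+-comm (sumUpTo m (λ i → binom m i * sumSeq i n h)) _ ⟩
      sumUpTo m (λ i → binom m i * sumSeq (suc i) n h) + sumUpTo m (λ i → binom m i * sumSeq i n h)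
    ≡⟨ sym (pascal m (λ i → sumSeq i n h)) ⟩
      sumUpTo (suc m) (λ i → binom (suc m) i * sumSeq i n h)
    ∎

  count : List Bool → ℕ → ℕ
  count S m = sumSeq m (length S) (λ a → 𝟙 (criterion S a))

  -- One step of the recursion for count: a street whose first space sees
  -- F free spaces from there on accepts at most F cars, and the cars
  -- passing the first space are counted by v.
  layer : ℕ → (ℕ → ℕ) → ℕ → ℕ
  layer F v m = 𝟙 (m ≤ᵇ F) * sumUpTo m (λ i → binom m i * v i)

  count-cons : ∀ b S m → count (b ∷ S) m ≡ layer (freeSpaces (b ∷ S)) (count S) m
  count-cons b S m =
    begin
      sumSeq m (suc (length S)) (λ a → 𝟙 ((length a ≤ᵇ F) ∧ criterion S (passFirst a)))
    ≡⟨ sumOver-cong (sequences m (suc (length S))) (λ a → 𝟙-∧ (length a ≤ᵇ F) (criterion S (passFirst a))) ⟩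
      sumSeq m (suc (length S)) (λ a → 𝟙 (length a ≤ᵇ F) * 𝟙 (criterion S (passFirst a)))
    ≡⟨ sumSeq-length m (suc (length S)) (λ l a → 𝟙 (l ≤ᵇ F) * 𝟙 (criterion S (passFirst a))) ⟩
      sumSeq m (suc (length S)) (λ a → 𝟙 (m ≤ᵇ F) * 𝟙 (criterion S (passFirst a)))
    ≡⟨ sumSeq-* m (suc (length S)) (𝟙 (m ≤ᵇ F)) (λ a → 𝟙 (criterion S (passFirst a))) ⟩
      𝟙 (m ≤ᵇ F) * sumSeq m (suc (length S)) (λ a → 𝟙 (criterion S (passFirst a)))
    ≡⟨ cong (𝟙 (m ≤ᵇ F) *_) (sumSeq-passFirst m (length S) (λ a → 𝟙 (criterion S a))) ⟩
      layer F (count S) m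
    ∎
    where
    F = freeSpaces (b ∷ S)

  layer-cong : ∀ F {u v : ℕ → ℕ} → (∀ i → u i ≡ v i) → ∀ m → layer F u m ≡ layer F v m
  layer-cong F eq m = cong (𝟙 (m ≤ᵇ F) *_) (sumUpTo-cong m (λ i → cong (binom m i *_) (eq i)))

  layer-≤ : ∀ F v m → m ≤ F → layer F v m ≡ sumUpTo m (λ i → binom m i * v i)
  layer-≤ F v m m≤F rewrite ≤⇒≤ᵇ≡true m≤F = ℕₚ.+-identityʳ _

  layer-+ : ∀ F (u v : ℕ → ℕ) m → layer F (λ i → u i + v i) m ≡ layer F u m + layer F v m
  layer-+ F u v m =
    trans (cong (𝟙 (m ≤ᵇ F) *_)
            (trans (sumUpTo-cong m (λ i → ℕₚ.*-distribˡ-+ (binom m i) (u i) (v i)))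
                   (sumUpTo-+ m (λ i → binom m i * u i) (λ i → binom m i * v i))))
          (ℕₚ.*-distribˡ-+ (𝟙 (m ≤ᵇ F)) _ _)

  sumOver-entries-single : ∀ n f l → 1 ≤ l → l ≤ n → (∀ x → x ≢ l → f x ≡ 0) → sumOver (entries n) f ≡ f l
  sumOver-entries-single (suc n) f (suc zero) _ _ vanish =
    trans (cong (λ xs → sumOver xs f) (entries-suc n)) (trans (cong (f 1 +_) (trans (sumOver-map (entries n) suc f)
                           (trans (sumOver-map (upTo n) suc (f ∘ suc))
                             (trans (sumOver-cong (upTo n) (λ y → vanish (suc (suc y)) (λ ())))
                                    (sumOver-0 (upTo n))))))
          (ℕₚ.+-identityʳ (f 1)))
  sumOver-entries-single (suc n) f (suc (suc l)) _ (s≤s l<n) vanish =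
    trans (cong (λ xs → sumOver xs f) (entries-suc n)) (trans (cong₂ _+_ (vanish 1 (λ ())) (sumOver-map (entries n) suc f))
          (sumOver-entries-single n (f ∘ suc) (suc l) (s≤s z≤n) l<n (λ x x≢l → vanish (suc x) (x≢l ∘ ℕₚ.suc-injective))))

  -- the street after the first car parked at space i+1 of an empty street
  oneParked : ℕ → ℕ → List Bool
  oneParked i r = replicate i false ++ true ∷ replicate r false

  length-oneParked : ∀ i r → length (oneParked i r) ≡ suc (i + r)
  length-oneParked zero r = cong suc (Listₚ.length-replicate r)
  length-oneParked (suc i) r = cong suc (length-oneParked i r)

  park-empty : ∀ i r → parkFrom (suc i) (replicate (suc (i + r)) false) ≡ just (oneParked i r)
  park-empty zero r = refl
  park-empty (suc i) r rewrite park-empty i r = refl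

  p-as-count : ∀ i r → p (suc (i + r)) (suc i) ≡ count (oneParked i r) (i + r)
  p-as-count i r =
    begin
      p n l
    ≡⟨ countTrue-sum _ (sequences n n) ⟩
      sumSeq (suc m) n (λ as → 𝟙 (isParkingFunction n as ∧ firstIs l as))
    ≡⟨ sumSeq-suc m n _ ⟩
      sumOver (entries n) firstCar
    ≡⟨ sumOver-entries-single n firstCar l (s≤s z≤n) (s≤s (ℕₚ.m≤m+n i r)) otherFirstCar ⟩
      sumSeq m n (λ a → 𝟙 (isParkingFunction n (l ∷ a) ∧ (l ≡ᵇ l)))
    ≡⟨ sumOver-cong (sequences m n) (λ a → cong 𝟙
         (trans (cong (isParkingFunction n (l ∷ a) ∧_) (≡ᵇ-refl l)) (Boolₚ.∧-identityʳ _))) ⟩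
      sumSeq m n (λ a → 𝟙 (isParkingFunction n (l ∷ a)))
    ≡⟨ sumOver-cong (sequences m n) (λ a → cong 𝟙 (trans (parks⇔criterion (l ∷ a) (replicate n false))
          (trans (criterion-step (replicate n false) l a) (cong (λ S → criterionAfter S a) (park-empty i r))))) ⟩
      sumSeq m n (λ a → 𝟙 (criterion (oneParked i r) a))
    ≡⟨ cong (λ k → sumSeq m k (λ a → 𝟙 (criterion (oneParked i r) a))) (sym (length-oneParked i r)) ⟩
      count (oneParked i r) m
    ∎
    where
    n = suc (i + r)
    m = i + r
    l = suc i
    firstCar : ℕ → ℕ
    firstCar x = sumSeq m n (λ a → 𝟙 (isParkingFunction n (x ∷ a) ∧ (x ≡ᵇ l)))
    otherFirstCar : ∀ x → x ≢ l → firstCar x ≡ 0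
    otherFirstCar x x≢l =
      trans (sumOver-cong (sequences m n) (λ a → cong (λ b → 𝟙 (isParkingFunction n (x ∷ a) ∧ b)) (≢⇒≡ᵇ≡false x≢l)))
        (trans (sumOver-cong (sequences m n) (λ a → cong 𝟙 (Boolₚ.∧-zeroʳ _))) (sumOver-0 (sequences m n)))

  binomial-theorem : ∀ m x → sumUpTo m (λ i → binom m i * x ^ i) ≡ suc x ^ m
  binomial-theorem zero x = refl
  binomial-theorem (suc m) x =
    begin
      sumUpTo (suc m) (λ i → binom (suc m) i * x ^ i)
    ≡⟨ pascal m (x ^_) ⟩
      sumUpTo m (λ i → binom m i * x ^ suc i) + B
    ≡⟨ cong (_+ B) (trans (sumUpTo-cong m (λ i → shift (binom m i) x (x ^ i))) (sumUpTo-* m x _)) ⟩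
      x * B + B
    ≡⟨ cong (λ z → x * z + z) (binomial-theorem m x) ⟩
      x * suc x ^ m + suc x ^ m
    ≡⟨ ℕₚ.+-comm (x * suc x ^ m) _ ⟩
      suc x ^ suc m
    ∎
    where
    B = sumUpTo m (λ i → binom m i * x ^ i)
    shift : ∀ b x y → b * (x * y) ≡ x * (b * y)
    shift = solve-∀

  -- Σ_i C(m,i) i x^i, the derivative of the binomial theorem (times x)
  binomialMoment : ℕ → ℕ → ℕ
  binomialMoment m x = sumUpTo m (λ i → binom m i * (i * x ^ i))

  binomial-derivative : ∀ m x → suc x * binomialMoment m x ≡ m * x * suc x ^ m
  binomial-derivative zero x = ℕₚ.*-zeroʳ (suc x)
  binomial-derivative (suc m) x =
    begin
      suc x * binomialMoment (suc m) x
    ≡⟨ cong (suc x *_) (pascal m (λ i → i * x ^ i)) ⟩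
      suc x * (sumUpTo m (λ i → binom m i * (suc i * x ^ suc i)) + D)
    ≡⟨ cong (λ z → suc x * (z + D))
         (trans (sumUpTo-cong m (λ i → shift (binom m i) i x (x ^ i)))
           (trans (sumUpTo-+ m _ _) (cong₂ _+_ (sumUpTo-* m x _) (sumUpTo-* m x _)))) ⟩
      suc x * (x * sumUpTo m (λ i → binom m i * x ^ i) + x * D + D)
    ≡⟨ cong (λ z → suc x * (x * z + x * D + D)) (binomial-theorem m x) ⟩
      suc x * (x * suc x ^ m + x * D + D)
    ≡⟨ expand x (suc x ^ m) D ⟩
      suc x * (x * suc x ^ m) + suc x * (suc x * D)
    ≡⟨ cong (λ z → suc x * (x * suc x ^ m) + suc x * z) (binomial-derivative m x) ⟩
      suc x * (x * suc x ^ m) + suc x * (m * x * suc x ^ m)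
    ≡⟨ collect x m (suc x ^ m) ⟩
      suc m * x * suc x ^ suc m
    ∎
    where
    D = binomialMoment m x
    shift : ∀ b i x y → b * (suc i * (x * y)) ≡ x * (b * y) + x * (b * (i * y))
    shift = solve-∀
    expand : ∀ x p d → suc x * (x * p + x * d + d) ≡ suc x * (x * p) + suc x * (suc x * d)
    expand = solve-∀
    collect : ∀ x m p → suc x * (x * p) + suc x * (m * x * p) ≡ suc m * x * (suc x * p)
    collect = solve-∀

  -- Abel-type identity: for m ≤ N,
  --   (N+1) Σ_i C(m,i) (N-i) N^i = N (N+1-m) (N+1)^m.
  -- Adding the moment identity to it reduces it to the binomial theorem.
  abel-sum : ∀ N m → m ≤ N →
    suc N * sumUpTo m (λ i → binom m i * ((N ∸ i) * N ^ i)) ≡ N * ((suc N ∸ m) * suc N ^ m)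
  abel-sum N m m≤N = ℕₚ.+-cancelʳ-≡ (m * N * Pw) _ _ both
    where
    Pw = suc N ^ m
    A = sumUpTo m (λ i → binom m i * ((N ∸ i) * N ^ i))
    D = binomialMoment m N
    regroup : ∀ b a i p → b * (a * p) + b * (i * p) ≡ b * ((a + i) * p)
    regroup = solve-∀
    swap : ∀ b n p → b * (n * p) ≡ n * (b * p)
    swap = solve-∀
    A+D : A + D ≡ N * Pw
    A+D =
      begin
        A + D
      ≡⟨ sym (sumUpTo-+ m _ _) ⟩
        sumUpTo m (λ i → binom m i * ((N ∸ i) * N ^ i) + binom m i * (i * N ^ i))
      ≡⟨ sumUpTo-cong≤ m (λ i i≤m → trans (regroup (binom m i) (N ∸ i) i (N ^ i))
           (trans (cong (λ z → binom m i * (z * N ^ i)) (ℕₚ.m∸n+n≡m (ℕₚ.≤-trans i≤m m≤N)))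
                  (swap (binom m i) N (N ^ i)))) ⟩
        sumUpTo m (λ i → N * (binom m i * N ^ i))
      ≡⟨ trans (sumUpTo-* m N _) (cong (N *_) (binomial-theorem m N)) ⟩
        N * Pw
      ∎
    split : ∀ n m p q → n * (q * p) + m * n * p ≡ n * ((q + m) * p)
    split = solve-∀
    both : suc N * A + m * N * Pw ≡ N * ((suc N ∸ m) * Pw) + m * N * Pw
    both =
      begin
        suc N * A + m * N * Pw
      ≡⟨ cong (suc N * A +_) (sym (binomial-derivative m N)) ⟩
        suc N * A + suc N * D
      ≡⟨ sym (ℕₚ.*-distribˡ-+ (suc N) A D) ⟩
        suc N * (A + D)
      ≡⟨ trans (cong (suc N *_) A+D) (swap (suc N) N Pw) ⟩
        N * (suc N * Pw)
      ≡⟨ cong (λ z → N * (z * Pw)) (sym (ℕₚ.m∸n+n≡m (ℕₚ.≤-trans m≤N (ℕₚ.n≤1+n N)))) ⟩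
        N * ((suc N ∸ m + m) * Pw)
      ≡⟨ sym (split N m Pw (suc N ∸ m)) ⟩
        N * ((suc N ∸ m) * Pw) + m * N * Pw
      ∎

  emptyCount : ℕ → ℕ → ℕ
  emptyCount n m = count (replicate n false) m

  freeSpaces-empty : ∀ n → freeSpaces (replicate n false) ≡ n
  freeSpaces-empty zero = refl
  freeSpaces-empty (suc n) = cong suc (freeSpaces-empty n)

  emptyCount-suc : ∀ n m → emptyCount (suc n) m ≡ layer (suc n) (emptyCount n) m
  emptyCount-suc n m =
    trans (count-cons false (replicate n false) m) (cong (λ F → layer (suc F) (emptyCount n) m) (freeSpaces-empty n))

  emptyCount-closed : ∀ n m → suc n * emptyCount n m ≡ (suc n ∸ m) * suc n ^ m
  emptyCount-closed zero zero = refl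
  emptyCount-closed zero (suc m) rewrite ℕₚ.0∸n≡0 m = refl
  emptyCount-closed (suc n) m with m ℕₚ.≤? suc n
  ... | no m≰N rewrite emptyCount-suc n m | ≰⇒≤ᵇ≡false m≰N | ℕₚ.m≤n⇒m∸n≡0 (ℕₚ.≰⇒> m≰N) =
    ℕₚ.*-zeroʳ (suc (suc n))
  ... | yes m≤N = ℕₚ.*-cancelˡ-≡ _ _ N
    (begin
      N * (suc N * emptyCount N m)
    ≡⟨ cong (λ z → N * (suc N * z)) (trans (emptyCount-suc n m) (layer-≤ N (emptyCount n) m m≤N)) ⟩
      N * (suc N * sumUpTo m (λ i → binom m i * emptyCount n i))
    ≡⟨ trans (reorder N (suc N) (sumUpTo m (λ i → binom m i * emptyCount n i))) (cong (suc N *_) (sym (sumUpTo-* m N _))) ⟩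
      suc N * sumUpTo m (λ i → N * (binom m i * emptyCount n i))
    ≡⟨ cong (suc N *_) (sumUpTo-cong m (λ i → trans (reorder N (binom m i) _)
                                              (cong (binom m i *_) (emptyCount-closed n i)))) ⟩
      suc N * sumUpTo m (λ i → binom m i * ((N ∸ i) * N ^ i))
    ≡⟨ abel-sum N m m≤N ⟩
      N * ((suc N ∸ m) * suc N ^ m)
    ∎)
    where
    N = suc n
    reorder : ∀ a b c → a * (b * c) ≡ b * (a * c)
    reorder = solve-∀

  emptyCount-full : ∀ m → emptyCount m m ≡ suc m ^ (m ∸ 1)
  emptyCount-full zero = refl
  emptyCount-full (suc m) = ℕₚ.*-cancelˡ-≡ _ _ (suc (suc m))
    (trans (emptyCount-closed (suc m) (suc m))
      (trans (cong (λ z → z * suc (suc m) ^ suc m) (ℕₚ.m+n∸n≡m 1 m)) (ℕₚ.+-identityʳ _)))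

  emptyCount-spare : ∀ m → suc (suc m) * emptyCount (suc m) m ≡ 2 * suc (suc m) ^ m
  emptyCount-spare m =
    trans (emptyCount-closed (suc m) m) (cong (λ z → z * suc (suc m) ^ m) (ℕₚ.m+n∸n≡m 2 m))

  binom-factorial : ∀ a b → binom (a + b) a * (a ! * b !) ≡ (a + b) !
  binom-factorial zero b = trans (ℕₚ.*-identityˡ _) (ℕₚ.*-identityˡ _)
  binom-factorial (suc a) zero
    rewrite ℕₚ.+-identityʳ a | binom-diag a | binom-> a (suc a) ℕₚ.≤-refl = unit (suc a !)
    where
    unit : ∀ x → 1 * (x * 1) ≡ x
    unit = solve-∀
  binom-factorial (suc a) (suc b) =
    begin
      (binom (a + suc b) a + binom (a + suc b) (suc a)) * (suc a * a ! * (suc b * b !))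
    ≡⟨ distribute (binom (a + suc b) a) (binom (a + suc b) (suc a)) (suc a) (a !) (suc b) (b !) ⟩
      binom (a + suc b) a * (a ! * (suc b * b !)) * suc a + binom (a + suc b) (suc a) * (suc a * a ! * b !) * suc b
    ≡⟨ cong₂ _+_ (cong (_* suc a) (binom-factorial a (suc b)))
         (cong (_* suc b) (trans (cong (λ z → binom z (suc a) * (suc a * a ! * b !)) (ℕₚ.+-suc a b))
                                 (binom-factorial (suc a) b))) ⟩
      (a + suc b) ! * suc a + (suc a + b) ! * suc b
    ≡⟨ cong (λ z → (a + suc b) ! * suc a + z ! * suc b) (sym (ℕₚ.+-suc a b)) ⟩
      (a + suc b) ! * suc a + (a + suc b) ! * suc b
    ≡⟨ collect ((a + suc b) !) a b ⟩
      suc (a + suc b) !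
    ∎
    where
    distribute : ∀ X Y sa a! sb b! →
      (X + Y) * (sa * a! * (sb * b!)) ≡ X * (a! * (sb * b!)) * sa + Y * (sa * a! * b!) * sb
    distribute = solve-∀
    collect : ∀ N a b → N * suc a + N * suc b ≡ suc (a + suc b) * N
    collect = solve-∀

  -- Choosing F+s out of F+t and then F out of those is choosing F out of
  -- F+t and then s out of the remaining t.
  binom-nested : ∀ F s t → s ≤ t → binom (F + t) (F + s) * binom (F + s) F ≡ binom (F + t) F * binom t s
  binom-nested F s t s≤t with t ∸ s | ℕₚ.m+[n∸m]≡n s≤t
  ... | u | refl = ℕₚ.*-cancelʳ-≡ _ _ (F ! * (s ! * u !)) {{nonZero}} (trans viaLeft (sym viaRight))
    where
    nonZero : NonZero (F ! * (s ! * u !))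
    nonZero = ℕₚ.m*n≢0 (F !) (s ! * u !) {{F ℕₚ.!≢0}} {{ℕₚ.m*n≢0 (s !) (u !) {{s ℕₚ.!≢0}} {{u ℕₚ.!≢0}}}}
    assocF : F + (s + u) ≡ F + s + u
    assocF = sym (ℕₚ.+-assoc F s u)
    left : ∀ b₁ b₂ f s u → b₁ * b₂ * (f * (s * u)) ≡ b₁ * ((b₂ * (f * s)) * u)
    left = solve-∀
    right : ∀ b₃ b₄ f s u → b₃ * b₄ * (f * (s * u)) ≡ b₃ * (f * (b₄ * (s * u)))
    right = solve-∀
    viaLeft : binom (F + (s + u)) (F + s) * binom (F + s) F * (F ! * (s ! * u !)) ≡ (F + (s + u)) !
    viaLeft rewrite assocF =
      trans (left (binom (F + s + u) (F + s)) (binom (F + s) F) (F !) (s !) (u !))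
        (trans (cong (λ z → binom (F + s + u) (F + s) * (z * u !)) (binom-factorial F s))
               (binom-factorial (F + s) u))
    viaRight : binom (F + (s + u)) F * binom (s + u) s * (F ! * (s ! * u !)) ≡ (F + (s + u)) !
    viaRight =
      trans (right (binom (F + (s + u)) F) (binom (s + u) s) (F !) (s !) (u !))
        (trans (cong (λ z → binom (F + (s + u)) F * (F ! * z)) (binom-factorial s u))
               (binom-factorial F (s + u)))

  -- A difference δ between the counts of two streets with the same
  -- number of free spaces F is transformed by each empty space in front.

  propagate : ℕ → ℕ → (ℕ → ℕ) → ℕ → ℕ
  propagate zero F δ = δ
  propagate (suc j) F δ = layer (suc j + F) (propagate j F δ)

  freeSpaces-empty-++ : ∀ j X → freeSpaces (replicate j false ++ X) ≡ j + freeSpaces X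
  freeSpaces-empty-++ zero X = refl
  freeSpaces-empty-++ (suc j) X = cong suc (freeSpaces-empty-++ j X)

  count-difference : ∀ X Y (δ : ℕ → ℕ) → (∀ m → count X m ≡ count Y m + δ m) → freeSpaces X ≡ freeSpaces Y →
    ∀ j m → count (replicate j false ++ X) m ≡ count (replicate j false ++ Y) m + propagate j (freeSpaces X) δ m
  count-difference X Y δ base sameFree zero m = base m
  count-difference X Y δ base sameFree (suc j) m =
    begin
      count (false ∷ replicate j false ++ X) m
    ≡⟨ count-cons false (replicate j false ++ X) m ⟩
      layer (suc (freeSpaces (replicate j false ++ X))) (count (replicate j false ++ X)) m
    ≡⟨ cong (λ F → layer (suc F) (count (replicate j false ++ X)) m) (freeSpaces-empty-++ j X) ⟩
      layer F (count (replicate j false ++ X)) m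
    ≡⟨ layer-cong F (count-difference X Y δ base sameFree j) m ⟩
      layer F (λ i → count (replicate j false ++ Y) i + propagate j (freeSpaces X) δ i) m
    ≡⟨ layer-+ F (count (replicate j false ++ Y)) (propagate j (freeSpaces X) δ) m ⟩
      layer F (count (replicate j false ++ Y)) m + propagate (suc j) (freeSpaces X) δ m
    ≡⟨ cong (λ F → layer (suc F) (count (replicate j false ++ Y)) m + propagate (suc j) (freeSpaces X) δ m)
         (sym (trans (freeSpaces-empty-++ j Y) (cong (j +_) (sym sameFree)))) ⟩
      layer (suc (freeSpaces (replicate j false ++ Y))) (count (replicate j false ++ Y)) m
        + propagate (suc j) (freeSpaces X) δ m
    ≡⟨ cong (_+ propagate (suc j) (freeSpaces X) δ m) (sym (count-cons false (replicate j false ++ Y) m)) ⟩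
      count (false ∷ replicate j false ++ Y) m + propagate (suc j) (freeSpaces X) δ m
    ∎
    where
    F = suc j + freeSpaces X

  propagate-zero : ∀ j F m → propagate j F (λ _ → 0) m ≡ 0
  propagate-zero zero F m = refl
  propagate-zero (suc j) F m =
    trans (cong (𝟙 (m ≤ᵇ suc j + F) *_)
            (sumUpTo-zero m _ (λ i _ → *-vanishesʳ (binom m i) (propagate-zero j F i))))
          (ℕₚ.*-zeroʳ (𝟙 (m ≤ᵇ suc j + F)))

  count-occupied-end : ∀ j m → count (replicate j false ++ [ true ]) m ≡ count (replicate j false) m
  count-occupied-end j m =
    begin
      count (replicate j false ++ [ true ]) m
    ≡⟨ count-difference [ true ] [] (λ _ → 0) lastSpace refl j m ⟩
      count (replicate j false ++ []) m + propagate j 0 (λ _ → 0) m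
    ≡⟨ cong₂ (λ S z → count S m + z) (Listₚ.++-identityʳ (replicate j false)) (propagate-zero j 0 m) ⟩
      count (replicate j false) m + 0
    ≡⟨ ℕₚ.+-identityʳ _ ⟩
      count (replicate j false) m
    ∎
    where
    lastSpace : ∀ m → count [ true ] m ≡ count [] m + 0
    lastSpace zero = refl
    lastSpace (suc m) = count-cons true [] (suc m)

  p-last : ∀ m → p (suc m) (suc m) ≡ suc m ^ (m ∸ 1)
  p-last m =
    begin
      p (suc m) (suc m)
    ≡⟨ cong (λ n → p (suc n) (suc m)) (sym (ℕₚ.+-identityʳ m)) ⟩
      p (suc (m + 0)) (suc m)
    ≡⟨ p-as-count m 0 ⟩
      count (replicate m false ++ [ true ]) (m + 0)
    ≡⟨ trans (count-occupied-end m (m + 0)) (cong (emptyCount m) (ℕₚ.+-identityʳ m)) ⟩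
      emptyCount m m
    ≡⟨ emptyCount-full m ⟩
      suc m ^ (m ∸ 1)
    ∎

  p-first : ∀ m → suc (suc m) * p (suc m) 1 ≡ 2 * suc (suc m) ^ m
  p-first m = trans (cong (suc (suc m) *_) asEmpty) (emptyCount-spare m)
    where
    asEmpty : p (suc m) 1 ≡ emptyCount (suc m) m
    asEmpty =
      trans (p-as-count 0 m)
        (trans (count-cons true (replicate m false) m)
          (trans (layer-≤ _ (emptyCount m) m (ℕₚ.≤-reflexive (sym (freeSpaces-empty m))))
            (sym (trans (emptyCount-suc m m) (layer-≤ (suc m) (emptyCount m) m (ℕₚ.n≤1+n m))))))

  Concentrated : ℕ → ℕ → (ℕ → ℕ) → Set
  Concentrated F K δ = (δ F ≡ K) × (∀ m → m ≢ F → δ m ≡ 0)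

  -- A layer at F keeps a difference concentrated at F: no fewer than F
  -- cars reach the difference, and no more than F are admitted.
  layer-concentrated : ∀ F K c → Concentrated F K c → Concentrated F K (layer F c)
  layer-concentrated F K c (atF , elsewhere) = atF′ , elsewhere′
    where
    atF′ : layer F c F ≡ K
    atF′ =
      trans (layer-≤ F c F ℕₚ.≤-refl)
        (trans (sumUpTo-top F _ (λ i i<F → *-vanishesʳ (binom F i) (elsewhere i (ℕₚ.<⇒≢ i<F))))
          (trans (cong₂ _*_ (binom-diag F) atF) (ℕₚ.*-identityˡ K)))
    elsewhere′ : ∀ m → m ≢ F → layer F c m ≡ 0
    elsewhere′ m m≢F with ℕₚ.<-cmp m F
    ... | tri< m<F _ _ =
      trans (cong (𝟙 (m ≤ᵇ F) *_) (sumUpTo-zero m _ (λ i i≤m →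
              *-vanishesʳ (binom m i) (elsewhere i (ℕₚ.<⇒≢ (ℕₚ.≤-<-trans i≤m m<F))))))
            (ℕₚ.*-zeroʳ (𝟙 (m ≤ᵇ F)))
    ... | tri≈ _ m≡F _ = ⊥-elim (m≢F m≡F)
    ... | tri> _ _ m>F rewrite ≰⇒≤ᵇ≡false (ℕₚ.<⇒≱ m>F) = refl

  ≤ᵇ-+ : ∀ a x y → (a + x ≤ᵇ a + y) ≡ (x ≤ᵇ y)
  ≤ᵇ-+ zero x y = refl
  ≤ᵇ-+ (suc a) x y = trans (≤ᵇ-suc (a + x) (a + y)) (≤ᵇ-+ a x y)

  -- A concentrated difference propagated through j empty spaces: it only
  -- affects F + t cars, which split into F cars reaching the difference
  -- and t cars counted as on j empty spaces.
  module _ (F K : ℕ) (δ : ℕ → ℕ) (conc : Concentrated F K δ) where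

    propagate-below : ∀ j m → m < F → propagate j F δ m ≡ 0
    propagate-below zero m m<F = proj₂ conc m (ℕₚ.<⇒≢ m<F)
    propagate-below (suc j) m m<F =
      trans (cong (𝟙 (m ≤ᵇ suc j + F) *_) (sumUpTo-zero m _ (λ i i≤m →
              *-vanishesʳ (binom m i) (propagate-below j i (ℕₚ.≤-<-trans i≤m m<F)))))
            (ℕₚ.*-zeroʳ (𝟙 (m ≤ᵇ suc j + F)))

    propagate-at : ∀ j t → propagate j F δ (F + t) ≡ binom (F + t) F * K * emptyCount j t
    propagate-at zero zero =
      trans (cong δ (ℕₚ.+-identityʳ F))
        (trans (proj₁ conc) (sym (trans (ℕₚ.*-identityʳ _) (trans (cong (_* K) (cong (λ n → binom n F) (ℕₚ.+-identityʳ F)))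
                                                             (trans (cong (_* K) (binom-diag F)) (ℕₚ.*-identityˡ K))))))
    propagate-at zero (suc t) =
      trans (proj₂ conc (F + suc t) (ℕₚ.m+1+n≢m F))
            (sym (ℕₚ.*-zeroʳ (binom (F + suc t) F * K)))
    propagate-at (suc j) t =
      begin
        𝟙 (F + t ≤ᵇ suc j + F) * sumUpTo (F + t) (λ i → binom (F + t) i * propagate j F δ i)
      ≡⟨ cong₂ _*_ (cong 𝟙 guard) shifted ⟩
        𝟙 (t ≤ᵇ suc j) * (binom (F + t) F * K * sumUpTo t (λ s → binom t s * emptyCount j s))
      ≡⟨ reorder (𝟙 (t ≤ᵇ suc j)) (binom (F + t) F * K) _ ⟩
        binom (F + t) F * K * layer (suc j) (emptyCount j) t
      ≡⟨ cong (binom (F + t) F * K *_) (sym (emptyCount-suc j t)) ⟩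
        binom (F + t) F * K * emptyCount (suc j) t
      ∎
      where
      guard : (F + t ≤ᵇ suc j + F) ≡ (t ≤ᵇ suc j)
      guard = trans (cong (F + t ≤ᵇ_) (ℕₚ.+-comm (suc j) F)) (≤ᵇ-+ F t (suc j))
      shifted : sumUpTo (F + t) (λ i → binom (F + t) i * propagate j F δ i)
              ≡ binom (F + t) F * K * sumUpTo t (λ s → binom t s * emptyCount j s)
      shifted =
        begin
          sumUpTo (F + t) (λ i → binom (F + t) i * propagate j F δ i)
        ≡⟨ sumUpTo-split F t _ (λ i i<F → *-vanishesʳ (binom (F + t) i) (propagate-below j i i<F)) ⟩
          sumUpTo t (λ s → binom (F + t) (F + s) * propagate j F δ (F + s))
        ≡⟨ sumUpTo-cong≤ t (λ s s≤t →
             trans (cong (binom (F + t) (F + s) *_) (propagate-at j s))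
               (trans (regroup (binom (F + t) (F + s)) (binom (F + s) F) K (emptyCount j s))
                 (trans (cong (λ z → z * K * emptyCount j s) (binom-nested F s t s≤t))
                        (regroup′ (binom (F + t) F) (binom t s) K (emptyCount j s))))) ⟩
          sumUpTo t (λ s → binom (F + t) F * K * (binom t s * emptyCount j s))
        ≡⟨ sumUpTo-* t (binom (F + t) F * K) _ ⟩
          binom (F + t) F * K * sumUpTo t (λ s → binom t s * emptyCount j s)
        ∎
        where
        regroup : ∀ a b k e → a * (b * k * e) ≡ a * b * k * e
        regroup = solve-∀
        regroup′ : ∀ a b k e → a * b * k * e ≡ a * k * (b * e)
        regroup′ = solve-∀
      reorder : ∀ g x s → g * (x * s) ≡ x * (g * s)
      reorder = solve-∀

  ≤ᵇ-split : ∀ i F → 𝟙 (i ≤ᵇ suc F) ≡ 𝟙 (i ≤ᵇ F) + 𝟙 (i ≡ᵇ suc F)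
  ≤ᵇ-split zero F = refl
  ≤ᵇ-split (suc zero) zero = refl
  ≤ᵇ-split (suc (suc i)) zero = refl
  ≤ᵇ-split (suc i) (suc F) rewrite ≤ᵇ-suc i (suc F) | ≤ᵇ-suc i F = ≤ᵇ-split i F

  layer-split : ∀ F v i → layer (suc F) v i ≡ layer F v i + 𝟙 (i ≡ᵇ suc F) * sumUpTo i (λ j → binom i j * v j)
  layer-split F v i rewrite ≤ᵇ-split i F = ℕₚ.*-distribʳ-+ _ (𝟙 (i ≤ᵇ F)) _

  -- the extra configurations when the occupied space comes first: exactly
  -- freeSpaces U + 1 cars pass the two spaces
  swapDefect : List Bool → ℕ → ℕ
  swapDefect U = layer (suc F) (λ i → 𝟙 (i ≡ᵇ suc F) * sumUpTo i (λ j → binom i j * count U j))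
    where F = freeSpaces U

  count-swap : ∀ U m → count (true ∷ false ∷ U) m ≡ count (false ∷ true ∷ U) m + swapDefect U m
  count-swap U m =
    trans (count-cons true (false ∷ U) m)
     (trans (layer-cong (suc F) (λ i → trans (count-cons false U i) (layer-split F (count U) i)) m)
      (trans (layer-+ (suc F) (layer F (count U)) extra m)
        (cong (_+ swapDefect U m) (sym (trans (count-cons false (true ∷ U) m)
                                              (layer-cong (suc F) (count-cons true U) m))))))
    where
    F = freeSpaces U
    extra : ℕ → ℕ
    extra i = 𝟙 (i ≡ᵇ suc F) * sumUpTo i (λ j → binom i j * count U j)

  swapDefect-concentrated : ∀ U → let F = suc (freeSpaces U) in Concentrated F (count (false ∷ U) F) (swapDefect U)
  swapDefect-concentrated U = layer-concentrated F K extra (atF , elsewhere)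
    where
    F = suc (freeSpaces U)
    K = count (false ∷ U) F
    extra : ℕ → ℕ
    extra i = 𝟙 (i ≡ᵇ F) * sumUpTo i (λ j → binom i j * count U j)
    atF : extra F ≡ K
    atF =
      trans (cong (λ b → 𝟙 b * sumUpTo F (λ j → binom F j * count U j)) (≡ᵇ-refl F))
        (trans (ℕₚ.*-identityˡ _) (sym (trans (count-cons false U F) (layer-≤ F (count U) F ℕₚ.≤-refl))))
    elsewhere : ∀ m → m ≢ F → extra m ≡ 0
    elsewhere m m≢F rewrite ≢⇒≡ᵇ≡false m≢F = refl

  empty-shift : ∀ j S → replicate (suc j) false ++ S ≡ replicate j false ++ false ∷ S
  empty-shift zero S = refl
  empty-shift (suc j) S = cong (false ∷_) (empty-shift j S)

  -- The streets after the first car parked at j+1 resp. j+2 differ by a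
  -- swap of an occupied and a free space behind j empty spaces.
  p-difference : ∀ k′ j → let k = suc k′ ; n = suc (k + j) in
    p n (suc j) ≡ p n (suc (suc j)) + binom (k + j) k * (suc k ^ k′ * suc j ^ (j ∸ 1))
  p-difference k′ j =
    begin
      p n (suc j)
    ≡⟨ cong (λ i → p (suc i) (suc j)) (ℕₚ.+-comm k j) ⟩
      p (suc (j + k)) (suc j)
    ≡⟨ p-as-count j k ⟩
      count (replicate j false ++ true ∷ false ∷ U) (j + k)
    ≡⟨ cong (count (replicate j false ++ true ∷ false ∷ U)) (ℕₚ.+-comm j k) ⟩
      count (replicate j false ++ true ∷ false ∷ U) (k + j)
    ≡⟨ count-difference (true ∷ false ∷ U) (false ∷ true ∷ U) (swapDefect U) (count-swap U) refl j (k + j) ⟩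
      count (replicate j false ++ false ∷ true ∷ U) (k + j) + propagate j F (swapDefect U) (k + j)
    ≡⟨ cong₂ _+_ nextStart defect ⟩
      p n (suc (suc j)) + binom (k + j) k * (suc k ^ k′ * suc j ^ (j ∸ 1))
    ∎
    where
    k = suc k′
    n = suc (k + j)
    U = replicate k′ false
    F = suc (freeSpaces U)
    F≡k : F ≡ k
    F≡k = cong suc (freeSpaces-empty k′)
    nextStart : count (replicate j false ++ false ∷ true ∷ U) (k + j) ≡ p n (suc (suc j))
    nextStart =
      sym (trans (cong (λ i → p (suc i) (suc (suc j))) (cong suc (ℕₚ.+-comm k′ j)))
            (trans (p-as-count (suc j) k′)
              (cong₂ count (empty-shift j (true ∷ U)) (cong suc (ℕₚ.+-comm j k′)))))
    defect : propagate j F (swapDefect U) (k + j) ≡ binom (k + j) k * (suc k ^ k′ * suc j ^ (j ∸ 1))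
    defect =
      begin
        propagate j F (swapDefect U) (k + j)
      ≡⟨ cong (λ f → propagate j F (swapDefect U) (f + j)) (sym F≡k) ⟩
        propagate j F (swapDefect U) (F + j)
      ≡⟨ propagate-at F (count (false ∷ U) F) (swapDefect U) (swapDefect-concentrated U) j j ⟩
        binom (F + j) F * count (false ∷ U) F * emptyCount j j
      ≡⟨ cong (λ f → binom (f + j) f * emptyCount k f * emptyCount j j) F≡k ⟩
        binom (k + j) k * emptyCount k k * emptyCount j j
      ≡⟨ cong₂ (λ a b → binom (k + j) k * a * b) (emptyCount-full k) (emptyCount-full j) ⟩
        binom (k + j) k * suc k ^ k′ * suc j ^ (j ∸ 1)
      ≡⟨ ℕₚ.*-assoc (binom (k + j) k) _ _ ⟩
        binom (k + j) k * (suc k ^ k′ * suc j ^ (j ∸ 1))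
      ∎

module Coefficients where

  open import Data.Nat as ℕ using (ℕ; zero; suc; _≤_; _<_; _∸_; _^_; _!; z≤n; s≤s; NonZero)
  import Data.Nat.Properties as ℕₚ
  open import Data.Nat.Tactic.RingSolver using (solve-∀)
  open import Data.Integer as ℤ using (+_)
  import Data.Integer.Properties as ℤₚ
  open import Data.Integer.Tactic.RingSolver using () renaming (solve-∀ to solveℤ)
  open import Data.Rational using (ℚ; _/_; _+_; _*_; _-_; 0ℚ; 1ℚ; toℚᵘ)
  import Data.Rational.Properties as ℚₚ
  open import Data.Rational.Unnormalised using (mkℚᵘ; *≡*)
    renaming (_≃_ to _≃ᵘ_; _+_ to _+ᵘ_; _*_ to _*ᵘ_)
  import Data.Rational.Unnormalised.Properties as ℚᵘₚ
  open import Data.Rational.Solver using (module +-*-Solver)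
  open +-*-Solver using (solve; _:+_; _:-_; _:*_; _:=_)
  open import Data.Sum using (inj₁; inj₂)
  open import Relation.Nullary using (yes; no)
  open import Relation.Binary using (tri<; tri≈; tri>)
  open import Relation.Binary.PropositionalEquality
  open ≡-Reasoning
  open Combinatorics
    using (≤⇒≤ᵇ≡true; ≰⇒≤ᵇ≡false; ≡ᵇ-refl; ≢⇒≡ᵇ≡false; binom; binom-factorial; p-last; p-first; p-difference)

  -- The natural numbers inside ℚ; sums and products are computed in ℚᵘ.
  ι : ℕ → ℚ
  ι n = + n / 1

  ι-as-ℚᵘ : ∀ a → toℚᵘ (ι a) ≃ᵘ mkℚᵘ (+ a) 0
  ι-as-ℚᵘ a = ℚₚ.toℚᵘ-fromℚᵘ (mkℚᵘ (+ a) 0)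

  ι-+ : ∀ a b → ι (a ℕ.+ b) ≡ ι a + ι b
  ι-+ a b = ℚₚ.toℚᵘ-injective (ℚᵘₚ.≃-trans (ι-as-ℚᵘ (a ℕ.+ b)) (ℚᵘₚ.≃-trans inℚᵘ
              (ℚᵘₚ.≃-sym (ℚᵘₚ.≃-trans (ℚₚ.toℚᵘ-homo-+ (ι a) (ι b)) (ℚᵘₚ.+-cong (ι-as-ℚᵘ a) (ι-as-ℚᵘ b))))))
    where
    normalise : ∀ x y → (x ℤ.+ y) ℤ.* ℤ.1ℤ ≡ (x ℤ.* ℤ.1ℤ ℤ.+ y ℤ.* ℤ.1ℤ) ℤ.* ℤ.1ℤ
    normalise = solveℤ
    inℚᵘ : mkℚᵘ (+ (a ℕ.+ b)) 0 ≃ᵘ (mkℚᵘ (+ a) 0 +ᵘ mkℚᵘ (+ b) 0)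
    inℚᵘ = *≡* (normalise (+ a) (+ b))

  ι-* : ∀ a b → ι (a ℕ.* b) ≡ ι a * ι b
  ι-* a b = ℚₚ.toℚᵘ-injective (ℚᵘₚ.≃-trans (ι-as-ℚᵘ (a ℕ.* b)) (ℚᵘₚ.≃-trans inℚᵘ
              (ℚᵘₚ.≃-sym (ℚᵘₚ.≃-trans (ℚₚ.toℚᵘ-homo-* (ι a) (ι b)) (ℚᵘₚ.*-cong (ι-as-ℚᵘ a) (ι-as-ℚᵘ b))))))
    where
    inℚᵘ : mkℚᵘ (+ (a ℕ.* b)) 0 ≃ᵘ (mkℚᵘ (+ a) 0 *ᵘ mkℚᵘ (+ b) 0)
    inℚᵘ = *≡* (cong (ℤ._* ℤ.1ℤ) (ℤₚ.pos-* a b))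

  inverse-ι : ∀ n .{{_ : NonZero n}} → (+ 1 / n) * ι n ≡ 1ℚ
  inverse-ι (suc n) = ℚₚ.toℚᵘ-injective (ℚᵘₚ.≃-trans (ℚₚ.toℚᵘ-homo-* (+ 1 / suc n) (ι (suc n)))
                        (ℚᵘₚ.≃-trans (ℚᵘₚ.*-cong (ℚₚ.toℚᵘ-fromℚᵘ (mkℚᵘ (+ 1) n)) (ι-as-ℚᵘ (suc n))) (*≡* cross)))
    where
    cross : (+ 1 ℤ.* + suc n) ℤ.* ℤ.1ℤ ≡ ℤ.1ℤ ℤ.* + suc (n ℕ.* 1)
    cross = trans (ℤₚ.*-identityʳ _) (trans (ℤₚ.*-identityˡ (+ suc n))
              (trans (cong (λ z → + suc z) (sym (ℕₚ.*-identityʳ n))) (sym (ℤₚ.*-identityˡ _))))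

  inv!-ι : ∀ m → inv! m * ι (m !) ≡ 1ℚ
  inv!-ι m = inverse-ι (m !) {{m ℕₚ.!≢0}}

  binom-inv! : ∀ k j → ι (binom (k ℕ.+ j) k) * inv! (k ℕ.+ j) ≡ inv! k * inv! j
  binom-inv! k j =
    begin
      B * I
    ≡⟨ sym (trans (cong₂ (λ x y → B * I * x * y) (inv!-ι k) (inv!-ι j)) (trans (ℚₚ.*-identityʳ _) (ℚₚ.*-identityʳ _))) ⟩
      B * I * (inv! k * ι (k !)) * (inv! j * ι (j !))
    ≡⟨ solve 6 (λ B I F₁ i₁ F₂ i₂ → B :* I :* (i₁ :* F₁) :* (i₂ :* F₂) := (B :* (F₁ :* F₂)) :* I :* (i₁ :* i₂))
             refl B I (ι (k !)) (inv! k) (ι (j !)) (inv! j) ⟩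
      B * (ι (k !) * ι (j !)) * I * (inv! k * inv! j)
    ≡⟨ cong (λ z → z * I * (inv! k * inv! j))
         (trans (cong (B *_) (sym (ι-* (k !) (j !))))
           (trans (sym (ι-* (binom (k ℕ.+ j) k) (k ! ℕ.* j !))) (cong ι (binom-factorial k j)))) ⟩
      ι ((k ℕ.+ j) !) * I * (inv! k * inv! j)
    ≡⟨ cong (_* (inv! k * inv! j)) (trans (ℚₚ.*-comm _ I) (inv!-ι (k ℕ.+ j))) ⟩
      1ℚ * (inv! k * inv! j)
    ≡⟨ ℚₚ.*-identityˡ _ ⟩
      inv! k * inv! j
    ∎
    where
    B = ι (binom (k ℕ.+ j) k)
    I = inv! (k ℕ.+ j)

  cP-as-ℕ : ∀ i → cP i ≡ ι (suc i ^ (i ∸ 1)) * inv! i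
  cP-as-ℕ zero = refl
  cP-as-ℕ (suc i) = refl

  sumTo-cong : ∀ n {a b : ℕ → ℚ} → (∀ i → a i ≡ b i) → sumTo n a ≡ sumTo n b
  sumTo-cong zero eq = eq 0
  sumTo-cong (suc n) eq = cong₂ _+_ (sumTo-cong n eq) (eq (suc n))

  sumTo-+ : ∀ n (a b : ℕ → ℚ) → sumTo n (λ i → a i + b i) ≡ sumTo n a + sumTo n b
  sumTo-+ zero a b = refl
  sumTo-+ (suc n) a b rewrite sumTo-+ n a b =
    solve 4 (λ x y z w → (x :+ y) :+ (z :+ w) := (x :+ z) :+ (y :+ w)) refl (sumTo n a) (sumTo n b) (a (suc n)) (b (suc n))

  sumTo-zero : ∀ n (h : ℕ → ℚ) → (∀ i → i ≤ n → h i ≡ 0ℚ) → sumTo n h ≡ 0ℚ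
  sumTo-zero zero h eq = eq 0 z≤n
  sumTo-zero (suc n) h eq rewrite sumTo-zero n h (λ i i≤n → eq i (ℕₚ.m≤n⇒m≤1+n i≤n)) | eq (suc n) ℕₚ.≤-refl = refl

  sumTo-single : ∀ n (h : ℕ → ℚ) j → (∀ i → i ≤ n → i ≢ j → h i ≡ 0ℚ) → j ≤ n → sumTo n h ≡ h j
  sumTo-single zero h .zero eq z≤n = refl
  sumTo-single (suc n) h j eq j≤n with ℕₚ.m≤n⇒m<n∨m≡n j≤n
  ... | inj₁ j<n rewrite sumTo-single n h j (λ i i≤n → eq i (ℕₚ.m≤n⇒m≤1+n i≤n)) (ℕₚ.≤-pred j<n)
                       | eq (suc n) ℕₚ.≤-refl (≢-sym (ℕₚ.<⇒≢ j<n)) = ℚₚ.+-identityʳ (h j)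
  ... | inj₂ refl rewrite sumTo-zero n h (λ i i≤n → eq i (ℕₚ.m≤n⇒m≤1+n i≤n) (ℕₚ.<⇒≢ (s≤s i≤n)))
    = ℚₚ.+-identityˡ (h (suc n))

  mono-elsewhere : ∀ c j i → i ≢ j → mono c j i ≡ 0ℚ
  mono-elsewhere c j i i≢j rewrite ≢⇒≡ᵇ≡false (≢-sym i≢j) = refl

  mono-at : ∀ c j → mono c j j ≡ c
  mono-at c j rewrite ≡ᵇ-refl j = refl

  ⊛-monoˡ : ∀ c j f n → j ≤ n → (mono c j ⊛ f) n ≡ c * f (n ∸ j)
  ⊛-monoˡ c j f n j≤n =
    trans (sumTo-single n (λ i → mono c j i * f (n ∸ i)) j
            (λ i _ i≢j → trans (cong (_* f (n ∸ i)) (mono-elsewhere c j i i≢j)) (ℚₚ.*-zeroˡ (f (n ∸ i)))) j≤n)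
          (cong (_* f (n ∸ j)) (mono-at c j))

  ⊛-monoˡ-below : ∀ c j f n → n < j → (mono c j ⊛ f) n ≡ 0ℚ
  ⊛-monoˡ-below c j f n n<j = sumTo-zero n (λ i → mono c j i * f (n ∸ i))
    (λ i i≤n → trans (cong (_* f (n ∸ i)) (mono-elsewhere c j i (ℕₚ.<⇒≢ (ℕₚ.≤-<-trans i≤n n<j))))
                     (ℚₚ.*-zeroˡ (f (n ∸ i))))

  ⊛-monoʳ : ∀ c j f n → j ≤ n → (f ⊛ mono c j) n ≡ f (n ∸ j) * c
  ⊛-monoʳ c j f n j≤n =
    trans (sumTo-single n (λ i → f i * mono c j (n ∸ i)) (n ∸ j)
            (λ i i≤n i≢n-j → trans (cong (f i *_) (mono-elsewhere c j (n ∸ i)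
                 (λ n-i≡j → i≢n-j (trans (sym (ℕₚ.m∸[m∸n]≡n i≤n)) (cong (n ∸_) n-i≡j)))))
               (ℚₚ.*-zeroʳ (f i))) (ℕₚ.m∸n≤m n j))
          (cong (f (n ∸ j) *_) (trans (cong (mono c j) (ℕₚ.m∸[m∸n]≡n j≤n)) (mono-at c j)))

  ⊛-monoʳ-below : ∀ c j f n → n < j → (f ⊛ mono c j) n ≡ 0ℚ
  ⊛-monoʳ-below c j f n n<j = sumTo-zero n (λ i → f i * mono c j (n ∸ i))
    (λ i i≤n → trans (cong (f i *_) (mono-elsewhere c j (n ∸ i) (ℕₚ.<⇒≢ (ℕₚ.≤-<-trans (ℕₚ.m∸n≤m n i) n<j))))
                     (ℚₚ.*-zeroʳ (f i)))

  ⊛-mono-comm : ∀ c j f n → (f ⊛ mono c j) n ≡ (mono c j ⊛ f) n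
  ⊛-mono-comm c j f n with j ℕₚ.≤? n
  ... | yes j≤n = trans (⊛-monoʳ c j f n j≤n) (trans (ℚₚ.*-comm (f (n ∸ j)) c) (sym (⊛-monoˡ c j f n j≤n)))
  ... | no j≰n = trans (⊛-monoʳ-below c j f n (ℕₚ.≰⇒> j≰n)) (sym (⊛-monoˡ-below c j f n (ℕₚ.≰⇒> j≰n)))

  ⊛-distribˡ-⊕ : ∀ (f g h : Series) n → (f ⊛ (g ⊕ h)) n ≡ (f ⊛ g) n + (f ⊛ h) n
  ⊛-distribˡ-⊕ f g h n = trans (sumTo-cong n (λ i → ℚₚ.*-distribˡ-+ (f i) (g (n ∸ i)) (h (n ∸ i))))
                               (sumTo-+ n (λ i → f i * g (n ∸ i)) (λ i → f i * h (n ∸ i)))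

  T-below : ∀ k n → n ≤ k → T k n ≡ 0ℚ
  T-below k n n≤k rewrite ≰⇒≤ᵇ≡false (ℕₚ.<⇒≱ (s≤s n≤k)) = refl

  T-from : ∀ k n → k < n → T k n ≡ ι (p n (n ∸ k)) * inv! (n ∸ 1)
  T-from k n k<n rewrite ≤⇒≤ᵇ≡true k<n = refl

  T₀-coefficient : ∀ n → T 0 n ≡ (X ⊛ P) n
  T₀-coefficient zero = refl
  T₀-coefficient (suc m) =
    begin
      ι (p (suc m) (suc m)) * inv! m
    ≡⟨ cong (λ z → ι z * inv! m) (p-last m) ⟩
      ι (suc m ^ (m ∸ 1)) * inv! m
    ≡⟨ sym (cP-as-ℕ m) ⟩
      cP m
    ≡⟨ sym (ℚₚ.*-identityˡ (cP m)) ⟩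
      ι 1 * P (suc m ∸ 1)
    ≡⟨ sym (⊛-monoˡ (ι 1) 1 P (suc m) (s≤s z≤n)) ⟩
      (X ⊛ P) (suc m)
    ∎

  p-first-coefficient : ∀ k′ → ι (p (suc k′) 1) * inv! k′ ≡ d (suc k′)
  p-first-coefficient zero = refl
  p-first-coefficient (suc k) =
    trans (cong (λ z → ι z * inv! (suc k)) p-first′) (cong (_* inv! (suc k)) (ι-* 2 (suc (suc (suc k)) ^ k)))
    where
    swap : ∀ x y z → x ℕ.* (y ℕ.* z) ≡ y ℕ.* (x ℕ.* z)
    swap = solve-∀
    p-first′ : p (suc (suc k)) 1 ≡ 2 ℕ.* suc (suc (suc k)) ^ k
    p-first′ = ℕₚ.*-cancelˡ-≡ _ _ (suc (suc (suc k)))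
      (trans (p-first (suc k)) (swap 2 (suc (suc (suc k))) (suc (suc (suc k)) ^ k)))

  T-step-coefficient : ∀ k′ j → let k = suc k′ ; n = suc (k ℕ.+ j) in T k n ≡ T k′ n + cP k * cP j
  T-step-coefficient k′ j =
    begin
      T k n
    ≡⟨ trans (T-from k n (s≤s (ℕₚ.m≤m+n k j))) (cong (λ i → ι (p n i) * I) n∸k) ⟩
      ι (p n (suc j)) * I
    ≡⟨ cong (λ z → ι z * I) (p-difference k′ j) ⟩
      ι (a ℕ.+ B ℕ.* (c ℕ.* e)) * I
    ≡⟨ cong (_* I) (trans (ι-+ a _) (cong (_+_ (ι a)) (trans (ι-* B _) (cong (ι B *_) (ι-* c e))))) ⟩
      (ι a + ι B * (ι c * ι e)) * I
    ≡⟨ solve 5 (λ a B c e I → (a :+ B :* (c :* e)) :* I := a :* I :+ (B :* I) :* (c :* e)) refl (ι a) (ι B) (ι c) (ι e) I ⟩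
      ι a * I + (ι B * I) * (ι c * ι e)
    ≡⟨ cong (λ z → ι a * I + z * (ι c * ι e)) (binom-inv! k j) ⟩
      ι a * I + (inv! k * inv! j) * (ι c * ι e)
    ≡⟨ cong (_+_ (ι a * I)) (ℚₚ.*-comm (inv! k * inv! j) _) ⟩
      ι a * I + (ι c * ι e) * (inv! k * inv! j)
    ≡⟨ cong (_+_ (ι a * I))
         (solve 4 (λ c e i₁ i₂ → (c :* e) :* (i₁ :* i₂) := (c :* i₁) :* (e :* i₂)) refl (ι c) (ι e) (inv! k) (inv! j)) ⟩
      ι a * I + (ι c * inv! k) * (ι e * inv! j)
    ≡⟨ cong₂ (λ x y → ι a * I + x * y) (sym (cP-as-ℕ k)) (sym (cP-as-ℕ j)) ⟩
      ι a * I + cP k * cP j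
    ≡⟨ cong (_+ cP k * cP j) (sym (trans (T-from k′ n (s≤s (ℕₚ.≤-trans (ℕₚ.n≤1+n k′) (ℕₚ.m≤m+n k j))))
                                          (cong (λ i → ι (p n i) * I) n∸k′))) ⟩
      T k′ n + cP k * cP j
    ∎
    where
    k = suc k′
    n = suc (k ℕ.+ j)
    I = inv! (k ℕ.+ j)
    a = p n (suc (suc j))
    B = binom (k ℕ.+ j) k
    c = suc k ^ k′
    e = suc j ^ (j ∸ 1)
    n∸k : n ∸ k ≡ suc j
    n∸k = trans (ℕₚ.+-∸-assoc 1 (ℕₚ.m≤m+n k j)) (cong suc (ℕₚ.m+n∸m≡n k j))
    n∸k′ : n ∸ k′ ≡ suc (suc j)
    n∸k′ = trans (ℕₚ.+-∸-assoc 2 (ℕₚ.m≤m+n k′ j)) (cong (λ i → suc (suc i)) (ℕₚ.m+n∸m≡n k′ j))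

  -- The recurrence, coefficientwise: below x^k both sides vanish, at x^k
  -- the term d_k cancels the lowest coefficient of T_{k-1}, and above it
  -- T-step-coefficient applies.
  recurrence : ∀ k′ n → let k = suc k′ in
    T k n ≡ ((T k′ ⊕ (mono (cP k) (suc k) ⊛ P)) ⊖ mono (d k) k) n
  recurrence k′ n with ℕₚ.<-cmp n (suc k′)
  ... | tri< n<k _ _ =
    trans (T-below k n (ℕₚ.<⇒≤ n<k))
      (sym (trans (cong₂ _-_ (cong₂ _+_ (T-below k′ n (ℕₚ.≤-pred n<k)) (⊛-monoˡ-below (cP k) (suc k) P n (ℕₚ.m≤n⇒m≤1+n n<k)))
                             (mono-elsewhere (d k) k n (ℕₚ.<⇒≢ n<k)))
                  (ℚₚ.+-identityʳ 0ℚ)))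
    where k = suc k′
  ... | tri≈ _ refl _ =
    trans (T-below k k ℕₚ.≤-refl)
      (sym (trans (cong₂ _-_ (cong₂ _+_ lowest (⊛-monoˡ-below (cP k) (suc k) P k ℕₚ.≤-refl)) (mono-at (d k) k))
                  (trans (cong (_- d k) (ℚₚ.+-identityʳ (d k))) (ℚₚ.+-inverseʳ (d k)))))
    where
    k = suc k′
    lowest : T k′ k ≡ d k
    lowest = trans (T-from k′ k ℕₚ.≤-refl)
               (trans (cong (λ i → ι (p k i) * inv! k′) (ℕₚ.m+n∸n≡m 1 k′)) (p-first-coefficient k′))
  ... | tri> _ _ k<n with n ∸ suc (suc k′) | ℕₚ.m+[n∸m]≡n k<n
  ...   | j | refl =
    trans (T-step-coefficient k′ j)
      (sym (trans (cong₂ _-_ (cong (_+_ (T k′ n)) (trans (⊛-monoˡ (cP k) (suc k) P n k<n)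
                                                         (cong (λ i → cP k * P i) (ℕₚ.m+n∸m≡n (suc k) j))))
                             (mono-elsewhere (d k) k n (≢-sym (ℕₚ.<⇒≢ k<n))))
                  (ℚₚ.+-identityʳ _)))
    where
    k = suc k′

  closed-form : ∀ k n →
    T k n ≡ ((P ⊛ sumSeries 0 k (λ i → mono (cP i) (suc i))) ⊖ sumSeries 1 k (λ i → mono (d i) i)) n
  closed-form zero n =
    begin
      T 0 n
    ≡⟨ T₀-coefficient n ⟩
      (X ⊛ P) n
    ≡⟨ sym (⊛-mono-comm (cP 0) 1 P n) ⟩
      (P ⊛ mono (cP 0) 1) n
    ≡⟨ sumTo-cong n (λ i → cong (P i *_) (sym (ℚₚ.+-identityˡ (mono (cP 0) 1 (n ∸ i))))) ⟩
      (P ⊛ sumSeries 0 0 (λ i → mono (cP i) (suc i))) n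
    ≡⟨ sym (ℚₚ.+-identityʳ _) ⟩
      (P ⊛ sumSeries 0 0 (λ i → mono (cP i) (suc i))) n - 0ℚ
    ∎
  closed-form (suc k′) n =
    begin
      T k n
    ≡⟨ recurrence k′ n ⟩
      (T k′ n + (Mk ⊛ P) n) - Dk n
    ≡⟨ cong (λ z → (z + (Mk ⊛ P) n) - Dk n) (closed-form k′ n) ⟩
      ((P ⊛ Ms) n - Ds n + (Mk ⊛ P) n) - Dk n
    ≡⟨ solve 4 (λ a h c m → ((a :- h) :+ c) :- m := (a :+ c) :- (h :+ m)) refl ((P ⊛ Ms) n) (Ds n) ((Mk ⊛ P) n) (Dk n) ⟩
      ((P ⊛ Ms) n + (Mk ⊛ P) n) - (Ds n + Dk n)
    ≡⟨ cong (λ z → ((P ⊛ Ms) n + z) - (Ds n + Dk n)) (sym (⊛-mono-comm (cP k) (suc k) P n)) ⟩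
      ((P ⊛ Ms) n + (P ⊛ Mk) n) - (Ds n + Dk n)
    ≡⟨ cong (_- (Ds n + Dk n)) (sym (⊛-distribˡ-⊕ P Ms Mk n)) ⟩
      (P ⊛ (Ms ⊕ Mk)) n - (Ds n + Dk n)
    ∎
    where
    k = suc k′
    Ms = sumSeries 0 k′ (λ i → mono (cP i) (suc i))
    Mk = mono (cP k) (suc k)
    Ds = sumSeries 1 k′ (λ i → mono (d i) i)
    Dk = mono (d k) k

open Coefficients using (T₀-coefficient; recurrence; closed-form)

theorem3p8 :
    (∀ n → T 0 n ≡ (X ⊛ P) n)
    × (∀ k → 1 ≤ k → ∀ n →
         T k n ≡ ((T (k ∸ 1) ⊕ (mono (cP k) (suc k) ⊛ P)) ⊖ mono (d k) k) n)
    × (∀ k → ∀ n →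
         T k n ≡ ((P ⊛ sumSeries 0 k (λ i → mono (cP i) (suc i)))
                   ⊖ sumSeries 1 k (λ i → mono (d i) i)) n)
theorem3p8 = T₀-coefficient , (λ { (suc k′) _ → recurrence k′ }) , closed-form
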